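{- Let $m,n$ be positive integers. For every arithmetical structure on $\mathcal{P}_{m,n}$, the label $a_m$ of the vertex $a_m$ satisfies $a_m\in\{1,2\}$.
   Context: For positive integers $m,n$, the multigraph $\mathcal{P}_{m,n}$ has vertices $a_1,\ldots,a_m,b_1,\ldots,b_n$, a single edge between $a_i$ and $a_{i+1}$ for $1\le i<m$, a single edge between $b_i$ and $b_{i+1}$ for $1\le i<n$, and two parallel edges between $a_1$ and $b_1$. An arithmetical structure is an assignment of a positive integer label to each vertex such that the set of all labels has greatest common divisor $1$ and each vertex's label divides the sum of its neighbors' labels counted with edge multiplicity (e.g. $a_1\mid a_2+2b_1$, with $a_2$ read as $0$ if $m=1$). -}

module Defs where

open import Data.Nat using (ℕ; zero; suc; _+_; _*_; _≤_; _<_; NonZero)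
open import Data.Nat.Divisibility using (_∣_)
open import Data.Product using (_×_)
import Data.Nat
import Relation.Nullary

-- Labels are functions  a b : ℕ → ℕ ; only a 1 … a m and b 1 … b n matter
-- (vertex a_i is labelled  a i , vertex b_j is labelled  b j ).

-- the label of a neighbour at index i on a path of length k,
-- read as 0 when i is not a vertex index (i = 0 or i > k)
lab : (k : ℕ) → (ℕ → ℕ) → ℕ → ℕ
lab k f zero = 0
lab k f (suc i) with suc i Data.Nat.≤? k
... | Relation.Nullary.yes _ = f (suc i)
... | Relation.Nullary.no _ = 0

-- sum of neighbours (with multiplicity) of vertex a_i in P_{m,n}
nbrA : (m n : ℕ) → (a b : ℕ → ℕ) → ℕ → ℕ
nbrA m n a b zero = 0
nbrA m n a b (suc zero) = lab m a 2 + 2 * b 1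
nbrA m n a b (suc (suc i)) = lab m a (suc i) + lab m a (suc (suc (suc i)))

record IsArithStruct (m n : ℕ) (a b : ℕ → ℕ) : Set where
  field
    posA  : ∀ i → 1 ≤ i → i ≤ m → 0 < a i
    posB  : ∀ j → 1 ≤ j → j ≤ n → 0 < b j
    gcd1  : ∀ d → (∀ i → 1 ≤ i → i ≤ m → d ∣ a i)
                → (∀ j → 1 ≤ j → j ≤ n → d ∣ b j) → d ∣ 1
    divA  : ∀ i → 1 ≤ i → i ≤ m → a i ∣ nbrA m n a b i
    divB  : ∀ j → 1 ≤ j → j ≤ n → b j ∣ nbrA n m b a j

module Submission where

-- The end label a_m of the a-arm divides twice every label, hence it divides 2.
--
-- Write d = a_m.  Walking down the a-arm, every vertex a_i (i ≥ 2) divides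
-- a_{i-1} + a_{i+1}; since d divides the two labels above a_{i-1}, it divides
-- a_{i-1}.  So d divides every a_i (end-divides).  The vertex a_1 divides
-- a_2 + 2 b_1, giving d ∣ 2 b_1; walking up the b-arm in the same way, with the
-- double edge contributing 2 a_1 at b_1, gives d ∣ 2 b_j for every j
-- (spread-up).  Finally, writing d as c or 2c with c = d / gcd(d,2), any
-- d ∣ 2x forces c ∣ x (halving); so c is a common divisor of all labels, hence
-- c = 1 and d ∈ {1, 2}.

open import Defs
open import Data.Nat using (ℕ; _≤_)
open import Data.Sum using (_⊎_)
open import Relation.Binary.PropositionalEquality using (_≡_)

open import Data.Nat using (zero; suc; pred; _+_; _*_; _∸_; _<_; z≤n; s≤s; _≤?_)
open import Data.Nat.Properties
  using (≤-trans; ≤-refl; n≤1+n; <⇒≱; ≰⇒>; +-identityʳ; +-suc; +-comm; m≤m+n;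
         *-assoc; *-comm; *-distribˡ-+; m+[n∸m]≡n)
open import Data.Nat.Divisibility
  using (_∣_; ∣-trans; ∣-refl; _∣0; ∣1⇒≡1; ∣m+n∣m⇒∣n; n∣m*n; m∣m*n;
         *-monoʳ-∣; *-cancelˡ-∣)
open import Data.Product using (_×_; _,_; proj₁; proj₂)
open import Data.Sum using (inj₁; inj₂) renaming (map to ⊎-map)
open import Relation.Nullary using (yes; no)
open import Relation.Binary.PropositionalEquality using (refl; sym; trans; cong; cong₂; subst; module ≡-Reasoning)
open import Data.Empty using (⊥-elim)

lab-in : ∀ k f i → 1 ≤ i → i ≤ k → lab k f i ≡ f i
lab-in k f (suc i) _ i≤k with suc i ≤? k
... | yes _ = refl
... | no i≰k = ⊥-elim (i≰k i≤k)

lab-out : ∀ k f i → k < i → lab k f i ≡ 0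
lab-out k f (suc i) k<i with suc i ≤? k
... | yes i≤k = ⊥-elim (<⇒≱ k<i i≤k)
... | no _ = refl

chase : ∀ {d x y z} → d ∣ x → d ∣ y → y ∣ x + z → d ∣ z
chase d∣x d∣y y∣x+z = ∣m+n∣m⇒∣n (∣-trans d∣y y∣x+z) d∣x

scaled-chase : ∀ {d x y z} k → d ∣ k * x → d ∣ k * y → y ∣ x + z → d ∣ k * z
scaled-chase {x = x} {y} {z} k d∣kx d∣ky y∣x+z =
  chase d∣kx d∣ky (subst (k * y ∣_) (*-distribˡ-+ k x z) (*-monoʳ-∣ k y∣x+z))

Balanced : ℕ → (ℕ → ℕ) → Set
Balanced k f = ∀ i → 2 ≤ i → i ≤ k → f i ∣ lab k f (pred i) + lab k f (suc i)

-- Each arm of P_{k,l} is balanced: away from the double edge the neighbour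
-- sum in P_{k,l} is the neighbour sum along the arm.
arm-balanced : ∀ k l f g → (∀ i → 1 ≤ i → i ≤ k → f i ∣ nbrA k l f g i)
             → Balanced k f
arm-balanced k l f g div (suc (suc i)) _ i≤k = div (suc (suc i)) (s≤s z≤n) i≤k
arm-balanced k l f g div (suc zero) (s≤s ()) _

step-down : ∀ {d} k f → Balanced k f → ∀ i → suc i ≤ k
          → d ∣ lab k f (suc i) → d ∣ lab k f (suc (suc i)) → d ∣ lab k f i
step-down {d} k f bal zero _ _ _ = d ∣0
step-down {d} k f bal (suc i) i+2≤k d∣y d∣z =
  chase d∣z (subst (d ∣_) (lab-in k f (suc (suc i)) (s≤s z≤n) i+2≤k) d∣y)
    (subst (f (suc (suc i)) ∣_) (+-comm (lab k f (suc i)) _)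
      (bal (suc (suc i)) (s≤s (s≤s z≤n)) i+2≤k))

end-label-self : ∀ k f → f k ∣ lab k f k
end-label-self zero f = f zero ∣0
end-label-self (suc k) f = subst (f (suc k) ∣_) (sym (lab-in (suc k) f (suc k) (s≤s z≤n) ≤-refl)) ∣-refl

end-divides : ∀ k f → Balanced k f → ∀ i → f k ∣ lab k f i
end-divides k f bal i with i ≤? k
... | no i≰k = subst (f k ∣_) (sym (lab-out k f i (≰⇒> i≰k))) (f k ∣0)
... | yes i≤k = proj₁ (down (k ∸ i) i (m+[n∸m]≡n i≤k))
  where
    -- descending induction on the distance t from the end, carrying two
    -- consecutive labels
    down : ∀ t i → i + t ≡ k → f k ∣ lab k f i × f k ∣ lab k f (suc i)
    down zero i i+0≡k =
      subst (λ j → f k ∣ lab k f j × f k ∣ lab k f (suc j)) k≡i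
        (end-label-self k f , subst (f k ∣_) (sym (lab-out k f (suc k) ≤-refl)) (f k ∣0))
      where
        k≡i : k ≡ i
        k≡i = sym (trans (sym (+-identityʳ i)) i+0≡k)
    down (suc t) i eq = step-down k f bal i i+1≤k (proj₁ above) (proj₂ above) , proj₁ above
      where
        eq′ : suc i + t ≡ k
        eq′ = trans (sym (+-suc i t)) eq
        above : f k ∣ lab k f (suc i) × f k ∣ lab k f (suc (suc i))
        above = down t (suc i) eq′
        i+1≤k : suc i ≤ k
        i+1≤k = subst (suc i ≤_) eq′ (m≤m+n (suc i) t)

-- Climbing the arm g_1 … g_n of P_{n,l} away from the double edge at g_1,
-- whose other end h_1 contributes 2 h_1 to the neighbour sum of g_1: a divisor
-- of k·(2 h_1) and k·g_1 divides k·g_j for every vertex of the arm.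
spread-up : ∀ n l (g h : ℕ → ℕ) k d
          → (∀ j → 1 ≤ j → j ≤ n → g j ∣ nbrA n l g h j)
          → d ∣ k * (2 * h 1) → d ∣ k * g 1
          → ∀ j → 1 ≤ j → j ≤ n → d ∣ k * g j
spread-up n l g h k d div d∣k2h d∣kg₁ (suc j) _ j+1≤n = proj₂ (up j j+1≤n)
  where
    -- the label preceding g_{j+1}: the outer contribution 2 h_1 before g_1
    prev : ℕ → ℕ
    prev zero = 2 * h 1
    prev (suc j) = g (suc j)

    link : ∀ j → suc (suc j) ≤ n → g (suc j) ∣ prev j + g (suc (suc j))
    link zero 2≤n =
      subst (g 1 ∣_) (trans (cong (_+ 2 * h 1) (lab-in n g 2 (s≤s z≤n) 2≤n)) (+-comm (g 2) _))
        (div 1 (s≤s z≤n) (≤-trans (n≤1+n 1) 2≤n))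
    link (suc j) j+3≤n =
      subst (g (suc (suc j)) ∣_)
        (cong₂ _+_ (lab-in n g (suc j) (s≤s z≤n) (≤-trans (n≤1+n _) j+2≤n))
                   (lab-in n g (suc (suc (suc j))) (s≤s z≤n) j+3≤n))
        (div (suc (suc j)) (s≤s z≤n) j+2≤n)
      where
        j+2≤n : suc (suc j) ≤ n
        j+2≤n = ≤-trans (n≤1+n _) j+3≤n

    up : ∀ j → suc j ≤ n → d ∣ k * prev j × d ∣ k * g (suc j)
    up zero _ = d∣k2h , d∣kg₁
    up (suc j) j+2≤n =
      let below = up j (≤-trans (n≤1+n _) j+2≤n)
      in proj₂ below , scaled-chase k (proj₁ below) (proj₂ below) (link j j+2≤n)

-- A halving of d is c = d / gcd(d, 2): d is c or 2c, and d ∣ 2x forces c ∣ x.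
record Halving (d : ℕ) : Set where
  field
    half   : ℕ
    shape  : d ≡ half ⊎ d ≡ 2 * half
    cancel : ∀ x → d ∣ 2 * x → half ∣ x

-- An odd number dividing 2x divides x:  x = (2e+1)x − e·(2x).
odd-cancel : ∀ e x → suc (2 * e) ∣ 2 * x → suc (2 * e) ∣ x
odd-cancel e x d∣2x = chase d∣2ex (m∣m*n x) (subst (suc (2 * e) * x ∣_) (+-comm x (2 * e * x)) ∣-refl)
  where
    open ≡-Reasoning
    reassoc : 2 * x * e ≡ 2 * e * x
    reassoc = begin
      2 * x * e   ≡⟨ *-assoc 2 x e ⟩
      2 * (x * e) ≡⟨ cong (2 *_) (*-comm x e) ⟩
      2 * (e * x) ≡⟨ *-assoc 2 e x ⟨
      2 * e * x   ∎

    d∣2ex : suc (2 * e) ∣ 2 * e * x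
    d∣2ex = subst (suc (2 * e) ∣_) reassoc (∣-trans d∣2x (m∣m*n e))

data Parity : ℕ → Set where
  even : ∀ e → Parity (2 * e)
  odd  : ∀ e → Parity (suc (2 * e))

parity : ∀ d → Parity d
parity zero = even 0
parity (suc d) with parity d
... | even e = odd e
... | odd e = subst Parity (cong suc (+-suc e (e + 0))) (even (suc e))

halving : ∀ d → Halving d
halving d with parity d
... | even e = record { half = e ; shape = inj₂ refl ; cancel = λ x → *-cancelˡ-∣ 2 }
... | odd e = record { half = suc (2 * e) ; shape = inj₁ refl ; cancel = odd-cancel e }

theorem2p9 : (m n : ℕ) → 1 ≤ m → 1 ≤ n → (a b : ℕ → ℕ)
    → IsArithStruct m n a b → (a m ≡ 1) ⊎ (a m ≡ 2)
theorem2p9 m n 1≤m _ a b S =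
  ⊎-map (λ am≡c → trans am≡c half≡1) (λ am≡2c → trans am≡2c (cong (2 *_) half≡1)) shape
  where
    open IsArithStruct S
    open Halving (halving (a m))

    am∣lab : ∀ i → a m ∣ lab m a i
    am∣lab = end-divides m a (arm-balanced m n a b divA)

    am∣a : ∀ i → 1 ≤ i → i ≤ m → a m ∣ a i
    am∣a i 1≤i i≤m = subst (a m ∣_) (lab-in m a i 1≤i i≤m) (am∣lab i)

    -- a_1 ∣ a_2 + 2 b_1 carries this to 2 b_1, and then up the b-arm
    am∣2b₁ : a m ∣ 2 * b 1
    am∣2b₁ = chase (am∣lab 2) (am∣a 1 ≤-refl 1≤m) (divA 1 ≤-refl 1≤m)

    am∣2b : ∀ j → 1 ≤ j → j ≤ n → a m ∣ 2 * b j
    am∣2b = spread-up n m b a 2 (a m) divB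
              (∣-trans (am∣a 1 ≤-refl 1≤m) (∣-trans (n∣m*n 2) (n∣m*n 2))) am∣2b₁

    -- so the halving of a_m divides every label, hence is 1
    half≡1 : half ≡ 1
    half≡1 = ∣1⇒≡1 (gcd1 half (λ i 1≤i i≤m → cancel (a i) (∣-trans (am∣a i 1≤i i≤m) (n∣m*n 2)))
                           (λ j 1≤j j≤n → cancel (b j) (am∣2b j 1≤j j≤n)))
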